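{- Let $a,\ell$ be integers with $1\le a<2^\ell$, and let $(r_n)_{n\ge0}$ be the sequence over $\mathbb{F}_2$ defined by $r_0=0$ and, for $n\ge 1$, \[ r_n=\begin{cases} r_{\lfloor n/2\rfloor}+1 & \text{if } n\equiv a \pmod{2^\ell},\\ r_{\lfloor n/2\rfloor} & \text{otherwise.}\end{cases} \] Then \[ C_2(r_n,N)>\frac{N}{2^\ell+2}-2\qquad\text{for all } N\ge 2^{\ell+1}+4 . \]
   Context: For a binary sequence $(s_n)$ over $\mathbb{F}_2=\{0,1\}$, the $N$th correlation measure of order $2$ is \[ C_2(s_n,N)=\max_{M,d_1,d_2}\left|\sum_{n=0}^{M}(-1)^{s_{n+d_1}+s_{n+d_2}}\right|, \] where the maximum is taken over all integers $M\ge 0$ and $0\le d_1<d_2$ with $d_2+M<N$. (The sequence $(r_n)$ is the pattern sequence: $r_n$ is the parity of the number of occurrences, in the binary expansion of $n$, of the length-$\ell$ pattern given by the binary expansion of $a$.) -}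

module Defs where

open import Data.Nat using (ℕ; zero; suc; _+_; _*_; _∸_; _^_; _<_; _≤_; _⊔_)
open import Data.Nat.DivMod using (_/_; _%_)
open import Data.Nat.Properties using (_≟_; m^n≢0)
open import Data.Bool using (Bool; true; false; not; _xor_; if_then_else_)
open import Data.Integer as ℤ using (ℤ; +_; ∣_∣)
open import Relation.Nullary.Decidable using (⌊_⌋)

-- Elements of F₂ are represented as Bool (false = 0, true = 1; addition = xor).

-- Pattern sequence r_n with parameters a, ℓ (fuel-based recursion;
-- the fuel n suffices since ⌊n/2⌋ < n for n ≥ 1).
rAux : ℕ → ℕ → ℕ → ℕ → Bool
rAux a ℓ zero n = false
rAux a ℓ (suc fuel) zero = false
rAux a ℓ (suc fuel) (suc m) =
  let n = suc m
      prev = rAux a ℓ fuel (n / 2)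
  in if ⌊ _%_ n (2 ^ ℓ) {{m^n≢0 2 ℓ}} ≟ _%_ a (2 ^ ℓ) {{m^n≢0 2 ℓ}} ⌋ then not prev else prev

r : ℕ → ℕ → ℕ → Bool
r a ℓ n = rAux a ℓ n n

sgn : Bool → ℤ
sgn false = + 1
sgn true  = ℤ.- (+ 1)

corrSum : (ℕ → Bool) → ℕ → ℕ → ℕ → ℤ
corrSum s zero d₁ d₂ = sgn (s d₁ xor s d₂)
corrSum s (suc M) d₁ d₂ = corrSum s M d₁ d₂ ℤ.+ sgn (s (suc M + d₁) xor s (suc M + d₂))

maxBelow : ℕ → (ℕ → ℕ) → ℕ
maxBelow zero f = 0
maxBelow (suc k) f = maxBelow k f ⊔ f k

admissibleVal : (ℕ → Bool) → ℕ → ℕ → ℕ → ℕ → ℕ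
admissibleVal s N M d₁ d₂ =
  if ⌊ suc d₁ Data.Nat.≤? d₂ ⌋ Data.Bool.∧ ⌊ suc (d₂ + M) Data.Nat.≤? N ⌋
  then ∣ corrSum s M d₁ d₂ ∣ else 0

-- C₂(s, N) = max over admissible M, d₁ < d₂ with d₂ + M < N of |Σ|
-- (all admissible triples have M, d₁, d₂ < N; empty max = 0).
C₂ : (ℕ → Bool) → ℕ → ℕ
C₂ s N = maxBelow N λ M → maxBelow N λ d₁ → maxBelow N λ d₂ → admissibleVal s N M d₁ d₂

{-# OPTIONS --safe #-}
-- Write ℓ = l + 1 and let D = 2^K · 2^l.  For n < 2^K the recursion for r (n + D) sees
-- the residues mod 2^ℓ of n, ⌊n/2⌋, … shifted only by multiples of 2^ℓ, and ends in a
-- power-of-two multiple of D, which never matches a; so r (n + D) = r n + r D.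
-- Hence the 2^K terms of the correlation sum with lags 0 and D all equal (-1)^(r D), and
-- C₂(r, N) ≥ 2^K as soon as D + 2^K = 2^K (2^l + 1) ≤ N.  Choosing K maximal with this
-- property gives N < 2^(K+1) (2^l + 1) = 2^K (2^ℓ + 2) ≤ (C₂(r, N) + 2)(2^ℓ + 2).
module Submission where

open import Defs
open import Data.Nat using (ℕ; _+_; _*_; _^_; _<_; _≤_)
open import Data.Nat as ℕ using (zero; suc; z≤n; s≤s; NonZero; >-nonZero; _<?_)
open import Data.Nat.Properties
open import Data.Nat.DivMod
open import Data.Nat.Divisibility using (_∣_; divides; divides-refl; ∣-refl; ∣n⇒∣m*n; n∣m⇒m%n≡0)
open import Data.Nat.Tactic.RingSolver using (solve-∀)
open import Data.Bool using (Bool; true; false; not; _xor_; if_then_else_)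
open import Data.Bool.Properties using (xor-assoc; xor-same)
open import Data.Integer as ℤ using (-[1+_]; ∣_∣)
open import Data.Product using (∃; _×_; _,_)
open import Data.Sum using (inj₁; inj₂)
open import Relation.Nullary using (Dec; yes; no; ¬_; contradiction)
open import Relation.Nullary.Decidable using (⌊_⌋; isYes≗does; dec-true; dec-false)
open import Relation.Binary.PropositionalEquality

isYes-true : ∀ {A : Set} (A? : Dec A) → A → ⌊ A? ⌋ ≡ true
isYes-true A? x = trans (isYes≗does A?) (dec-true A? x)

isYes-false : ∀ {A : Set} (A? : Dec A) → ¬ A → ⌊ A? ⌋ ≡ false
isYes-false A? ¬x = trans (isYes≗does A?) (dec-false A? ¬x)

xor-cancelˡ : ∀ x y → x xor (x xor y) ≡ y
xor-cancelˡ x y = trans (sym (xor-assoc x x y)) (cong (_xor y) (xor-same x))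

n<2^n : ∀ n → n < 2 ^ n
n<2^n zero = s≤s z≤n
n<2^n (suc n) = subst (suc (suc n) ≤_) (cong (2 ^ n +_) (sym (+-identityʳ (2 ^ n))))
  (+-mono-≤ (m^n>0 2 n) (n<2^n n))

dyadicBlock : ∀ c N → 0 < c → c ≤ N → ∃ λ K → 2 ^ K * c ≤ N × N < 2 ^ suc K * c
dyadicBlock c N 0<c c≤N = search N (<-≤-trans (n<2^n N) (m≤m*n (2 ^ N) c {{>-nonZero 0<c}}))
  where
  search : ∀ t → N < 2 ^ t * c → ∃ λ K → 2 ^ K * c ≤ N × N < 2 ^ suc K * c
  search zero N<c = contradiction c≤N (<⇒≱ (subst (N <_) (+-identityʳ c) N<c))
  search (suc t) N<2^[1+t]c with N <? 2 ^ t * c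
  ... | yes N<2^tc = search t N<2^tc
  ... | no N≮2^tc = t , ≮⇒≥ N≮2^tc , N<2^[1+t]c

module PatternSequence (a ℓ : ℕ) where

  private instance
    2^ℓ≢0 : NonZero (2 ^ ℓ)
    2^ℓ≢0 = m^n≢0 2 ℓ

  matches : ℕ → Bool
  matches n = ⌊ n % 2 ^ ℓ ≟ a % 2 ^ ℓ ⌋

  private
    if-not≡xor : ∀ b p → (if b then not p else p) ≡ b xor p
    if-not≡xor true p = refl
    if-not≡xor false p = refl

    1+m/2≤m : ∀ m → suc m / 2 ≤ m
    1+m/2≤m m = ≤-pred (m/n<m (suc m) 2 (s≤s (s≤s z≤n)))

  rAux-fuel : ∀ f g n → n ≤ f → n ≤ g → rAux a ℓ f n ≡ rAux a ℓ g n
  rAux-fuel zero zero zero _ _ = refl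
  rAux-fuel zero (suc g) zero _ _ = refl
  rAux-fuel (suc f) zero zero _ _ = refl
  rAux-fuel (suc f) (suc g) zero _ _ = refl
  rAux-fuel (suc f) (suc g) (suc m) (s≤s m≤f) (s≤s m≤g) =
    cong (λ p → if matches (suc m) then not p else p)
      (rAux-fuel f g (suc m / 2) (≤-trans (1+m/2≤m m) m≤f) (≤-trans (1+m/2≤m m) m≤g))

  r-step : ∀ n → .{{NonZero n}} → r a ℓ n ≡ matches n xor r a ℓ (n / 2)
  r-step (suc m) = trans
    (cong (λ p → if matches (suc m) then not p else p)
      (rAux-fuel m (suc m / 2) (suc m / 2) (1+m/2≤m m) ≤-refl))
    (if-not≡xor (matches (suc m)) (r a ℓ (suc m / 2)))

  matches-+-multiple : ∀ n {d} → 2 ^ ℓ ∣ d → matches (n + d) ≡ matches n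
  matches-+-multiple n (divides-refl q) =
    cong (λ x → ⌊ x ≟ a % 2 ^ ℓ ⌋) ([m+kn]%n≡m%n n q (2 ^ ℓ))

  a%2^ℓ≢0 : 1 ≤ a → a < 2 ^ ℓ → a % 2 ^ ℓ ≢ 0
  a%2^ℓ≢0 1≤a a<2^ℓ a%2^ℓ≡0 = m<n⇒n≢0 1≤a (trans (sym (m<n⇒m%n≡m a<2^ℓ)) a%2^ℓ≡0)

  matches-multiple : a % 2 ^ ℓ ≢ 0 → ∀ {d} → 2 ^ ℓ ∣ d → matches d ≡ false
  matches-multiple a≢0 {d} 2^ℓ∣d = isYes-false (d % 2 ^ ℓ ≟ a % 2 ^ ℓ) d≢a
    where
    d≢a : d % 2 ^ ℓ ≢ a % 2 ^ ℓ
    d≢a d≡a = a≢0 (trans (sym d≡a) (n∣m⇒m%n≡0 d (2 ^ ℓ) 2^ℓ∣d))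

  r-double : a % 2 ^ ℓ ≢ 0 → ∀ d → 2 ^ ℓ ∣ 2 * d → r a ℓ (2 * d) ≡ r a ℓ d
  r-double a≢0 zero _ = refl
  r-double a≢0 d@(suc _) 2^ℓ∣2d = begin
    r a ℓ (2 * d)                          ≡⟨ r-step (2 * d) ⟩
    matches (2 * d) xor r a ℓ (2 * d / 2)  ≡⟨ cong₂ _xor_ (matches-multiple a≢0 2^ℓ∣2d)
                                                         (cong (r a ℓ) 2d/2≡d) ⟩
    r a ℓ d                                ∎
    where open ≡-Reasoning
          2d/2≡d : 2 * d / 2 ≡ d
          2d/2≡d = trans (cong (_/ 2) (*-comm 2 d)) (m*n/n≡m d 2)

  -- 2^ℓ ∣ 2x makes every 2^(K+1)·x a multiple of 2^ℓ: invisible to `matches`, and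
  -- unchanged by r under halving.
  r-shift : a % 2 ^ ℓ ≢ 0 → ∀ x → 2 ^ ℓ ∣ 2 * x →
            ∀ K n → n < 2 ^ K → r a ℓ (n + 2 ^ K * x) ≡ r a ℓ n xor r a ℓ (2 ^ K * x)
  r-shift a≢0 x 2^ℓ∣2x zero zero _ = refl
  r-shift a≢0 x 2^ℓ∣2x zero (suc n) (s≤s ())
  r-shift a≢0 x 2^ℓ∣2x (suc K) zero _ = refl
  r-shift a≢0 x 2^ℓ∣2x (suc K) n@(suc _) n<2^[1+K] = begin
    r a ℓ (n + D′)                                 ≡⟨ r-step (n + D′) ⟩
    matches (n + D′) xor r a ℓ ((n + D′) / 2)      ≡⟨ cong₂ _xor_ (matches-+-multiple n 2^ℓ∣D′)
                                                                  (cong (r a ℓ) halve) ⟩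
    matches n xor r a ℓ (n / 2 + D)                ≡⟨ cong (matches n xor_)
                                                        (r-shift a≢0 x 2^ℓ∣2x K (n / 2) n/2<2^K) ⟩
    matches n xor (r a ℓ (n / 2) xor r a ℓ D)      ≡⟨ sym (xor-assoc (matches n) _ _) ⟩
    (matches n xor r a ℓ (n / 2)) xor r a ℓ D      ≡⟨ cong₂ _xor_ (sym (r-step n)) D-invariant ⟩
    r a ℓ n xor r a ℓ D′                           ∎
    where
    open ≡-Reasoning
    D = 2 ^ K * x
    D′ = 2 ^ suc K * x
    D′≡2D : D′ ≡ 2 * D
    D′≡2D = *-assoc 2 (2 ^ K) x
    2^ℓ∣D′ : 2 ^ ℓ ∣ D′
    2^ℓ∣D′ = subst (2 ^ ℓ ∣_) (y[2x]≡[2y]x (2 ^ K) x) (∣n⇒∣m*n (2 ^ K) 2^ℓ∣2x)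
      where y[2x]≡[2y]x : ∀ y x → y * (2 * x) ≡ (2 * y) * x
            y[2x]≡[2y]x = solve-∀
    2^ℓ∣2D : 2 ^ ℓ ∣ 2 * D
    2^ℓ∣2D = subst (2 ^ ℓ ∣_) D′≡2D 2^ℓ∣D′
    halve : (n + D′) / 2 ≡ n / 2 + D
    halve = begin
      (n + D′) / 2      ≡⟨ cong (λ y → (n + y) / 2) (trans D′≡2D (*-comm 2 D)) ⟩
      (n + D * 2) / 2   ≡⟨ +-distrib-/-∣ʳ n (divides D refl) ⟩
      n / 2 + D * 2 / 2 ≡⟨ cong (n / 2 +_) (m*n/n≡m D 2) ⟩
      n / 2 + D         ∎
    n/2<2^K : n / 2 < 2 ^ K
    n/2<2^K = m<n*o⇒m/o<n (subst (n <_) (*-comm 2 (2 ^ K)) n<2^[1+K])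
    D-invariant : r a ℓ D ≡ r a ℓ D′
    D-invariant = sym (trans (cong (r a ℓ) D′≡2D) (r-double a≢0 D 2^ℓ∣2D))

corrSum-constant : ∀ s M d₁ d₂ c → (∀ j → j ≤ M → s (j + d₁) xor s (j + d₂) ≡ c) →
                   corrSum s M d₁ d₂ ≡ (if c then -[1+ M ] else ℤ.+ suc M)
corrSum-constant s zero d₁ d₂ c terms rewrite terms 0 z≤n with c
... | false = refl
... | true = refl
corrSum-constant s (suc M) d₁ d₂ c terms
  rewrite corrSum-constant s M d₁ d₂ c (λ j j≤M → terms j (m≤n⇒m≤1+n j≤M))
        | terms (suc M) ≤-refl with c
... | false = cong (λ k → ℤ.+ suc k) (+-comm M 1)
... | true = cong (λ k → -[1+ suc k ]) (+-identityʳ M)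

∣corrSum∣-constant : ∀ s M d₁ d₂ c → (∀ j → j ≤ M → s (j + d₁) xor s (j + d₂) ≡ c) →
                     ∣ corrSum s M d₁ d₂ ∣ ≡ suc M
∣corrSum∣-constant s M d₁ d₂ c terms rewrite corrSum-constant s M d₁ d₂ c terms with c
... | false = refl
... | true = refl

maxBelow-upperBound : ∀ k f i → i < k → f i ≤ maxBelow k f
maxBelow-upperBound (suc k) f i i<1+k with m≤n⇒m<n∨m≡n (≤-pred i<1+k)
... | inj₁ i<k = ≤-trans (maxBelow-upperBound k f i i<k) (m≤m⊔n _ _)
... | inj₂ refl = m≤n⊔m _ _

∣corrSum∣≤C₂ : ∀ s N M d₁ d₂ → d₁ < d₂ → d₂ + M < N → ∣ corrSum s M d₁ d₂ ∣ ≤ C₂ s N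
∣corrSum∣≤C₂ s N M d₁ d₂ d₁<d₂ d₂+M<N = begin
  ∣ corrSum s M d₁ d₂ ∣                                    ≡⟨ sym admissible ⟩
  admissibleVal s N M d₁ d₂                                ≤⟨ maxBelow-upperBound N _ d₂ d₂<N ⟩
  maxBelow N (admissibleVal s N M d₁)                      ≤⟨ maxBelow-upperBound N _ d₁ (<-trans d₁<d₂ d₂<N) ⟩
  maxBelow N (λ d₁ → maxBelow N (admissibleVal s N M d₁))  ≤⟨ maxBelow-upperBound N _ M M<N ⟩
  C₂ s N                                                   ∎
  where
  open ≤-Reasoning
  d₂<N : d₂ < N
  d₂<N = ≤-<-trans (m≤m+n d₂ M) d₂+M<N
  M<N : M < N
  M<N = ≤-<-trans (m≤n+m M d₂) d₂+M<N
  admissible : admissibleVal s N M d₁ d₂ ≡ ∣ corrSum s M d₁ d₂ ∣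
  admissible rewrite isYes-true (suc d₁ ℕ.≤? d₂) d₁<d₂
                   | isYes-true (suc (d₂ + M) ℕ.≤? N) d₂+M<N = refl

C₂-≥-constantRun : ∀ s N P d₁ d₂ c → (∀ j → j < P → s (j + d₁) xor s (j + d₂) ≡ c) →
                   d₁ < d₂ → d₂ + P ≤ N → P ≤ C₂ s N
C₂-≥-constantRun s N zero d₁ d₂ c terms d₁<d₂ d₂+P≤N = z≤n
C₂-≥-constantRun s N (suc M) d₁ d₂ c terms d₁<d₂ d₂+P≤N =
  subst (_≤ C₂ s N) (∣corrSum∣-constant s M d₁ d₂ c (λ j j≤M → terms j (s≤s j≤M)))
    (∣corrSum∣≤C₂ s N M d₁ d₂ d₁<d₂ (subst (_≤ N) (+-suc d₂ M) d₂+P≤N))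

C₂-r-≥2^K : ∀ a l → 1 ≤ a → a < 2 ^ suc l →
         ∀ K N → 2 ^ K * (2 ^ l + 1) ≤ N → 2 ^ K ≤ C₂ (r a (suc l)) N
C₂-r-≥2^K a l 1≤a a<2^ℓ K N block≤N =
  C₂-≥-constantRun s N (2 ^ K) 0 D (s D) terms (*-mono-≤ (m^n>0 2 K) (m^n>0 2 l))
    (subst (_≤ N) (y[x+1]≡yx+y (2 ^ K) (2 ^ l)) block≤N)
  where
  open PatternSequence a (suc l)
  s = r a (suc l)
  D = 2 ^ K * 2 ^ l
  terms : ∀ j → j < 2 ^ K → s (j + 0) xor s (j + D) ≡ s D
  terms j j<2^K = begin
    s (j + 0) xor s (j + D)     ≡⟨ cong₂ _xor_ (cong s (+-identityʳ j))
                                     (r-shift (a%2^ℓ≢0 1≤a a<2^ℓ) (2 ^ l) ∣-refl K j j<2^K) ⟩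
    s j xor (s j xor s D)       ≡⟨ xor-cancelˡ (s j) (s D) ⟩
    s D                         ∎
    where open ≡-Reasoning
  y[x+1]≡yx+y : ∀ y x → y * (x + 1) ≡ y * x + y
  y[x+1]≡yx+y = solve-∀

corollary1 : (a ℓ : ℕ) → 1 ≤ a → a < 2 ^ ℓ →
    (N : ℕ) → 2 ^ (ℓ + 1) + 4 ≤ N →
    N < (C₂ (r a ℓ) N + 2) * (2 ^ ℓ + 2)
corollary1 a zero 1≤a a<1 N _ = contradiction 1≤a (<⇒≱ a<1)
corollary1 a (suc l) 1≤a a<2^ℓ N N≥ with dyadicBlock (2 ^ l + 1) N (m≤n+m 1 (2 ^ l)) c≤N
  where
  c≤N : 2 ^ l + 1 ≤ N
  c≤N = ≤-trans (+-mono-≤ (^-monoʳ-≤ 2 (m≤n⇒m≤1+n (m≤m+n l 1))) (s≤s z≤n)) N≥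
... | K , lo , hi = begin-strict
  N                                  <⟨ hi ⟩
  2 ^ suc K * (2 ^ l + 1)            ≡⟨ regroup (2 ^ K) (2 ^ l) ⟩
  2 ^ K * (2 ^ suc l + 2)            ≤⟨ *-monoˡ-≤ (2 ^ suc l + 2) (≤-trans 2^K≤C₂ (m≤m+n _ 2)) ⟩
  (C₂ (r a (suc l)) N + 2) * (2 ^ suc l + 2) ∎
  where
  open ≤-Reasoning
  2^K≤C₂ : 2 ^ K ≤ C₂ (r a (suc l)) N
  2^K≤C₂ = C₂-r-≥2^K a l 1≤a a<2^ℓ K N lo
  regroup : ∀ y x → (2 * y) * (x + 1) ≡ y * (2 * x + 2)
  regroup = solve-∀
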